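{- For all $k,l\ge1$, $(\lambda-1)(\mathfrak{W}'_k)\,L_{z_l}\subset\mathfrak{W}'_{k+l}$, i.e. for every $X\in\mathfrak{W}'_k$ the operator $(\lambda(X)-X)L_{z_l}$ on $\mathfrak{H}^1$ lies in $\mathfrak{W}'_{k+l}$.
   Context: $\mathfrak{H}=\mathbb{Q}\langle x,y\rangle$, $\mathfrak{H}^1=\mathbb{Q}+\mathfrak{H}y$, $\mathfrak{H}^1_n$ its homogeneous part of degree $n$ ($x,y$ of degree 1), $z_k=x^{k-1}y$, $L_u(w)=uw$. The harmonic product $*$ is the $\mathbb{Q}$-bilinear product on $\mathfrak{H}^1$ with $1*w=w*1=w$ and $z_kw*z_lw'=z_k(w*z_lw')+z_l(z_kw*w')+z_{k+l}(w*w')$; $\mathcal{H}_w(v)=w*v$. $\mathfrak{W}$ is the $\mathbb{Q}$-span of $\{\mathcal{H}_w:w\in\mathfrak{H}^1\}$, $\mathfrak{W}'$ the span of $\{L_{z_k}\mathcal{H}_w:k\ge1,w\in\mathfrak{H}^1\}$, and $\mathfrak{W}'_n$ the span of $\{L_{z_k}\mathcal{H}_w:1\le k\le n,\ w\in\mathfrak{H}^1_{n-k}\}$ (operators on $\mathfrak{H}^1$). The operators $L_{z_k}\mathcal{H}_w$ ($k\ge1$, $w$ a word) are linearly independent and $\lambda:\mathfrak{W}'\to\mathfrak{W}$ is the linear map with $\lambda(L_{z_k}\mathcal{H}_w)=\mathcal{H}_{z_kw}$. -}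

module Defs where

open import Data.Nat as ℕ using (ℕ; zero; suc; _≤_; _∸_)
open import Data.Rational as Q using (ℚ; 1ℚ; 0ℚ)
open import Data.List using (List; []; _∷_; _++_; map; concatMap)
open import Data.Nat.ListAction using (sum)
open import Data.List.Relation.Unary.All using (All)
open import Data.List.Properties using (≡-dec)
open import Data.Product using (_×_; _,_)
open import Relation.Binary.PropositionalEquality using (_≡_)
open import Relation.Nullary using (yes; no)

-- H^1 = Q + H y is the free algebra on the letters z_1, z_2, ...
-- (every word of H^1 is uniquely a product z_{k1} ... z_{kr}).
-- A letter is encoded by a natural number i standing for z_{i+1}.
Letter : Set
Letter = ℕ

-- the letter z_k (intended for k ≥ 1)
z : ℕ → Letter
z k = k ∸ 1

degL : Letter → ℕ
degL i = suc i

Word : Set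
Word = List Letter

deg : Word → ℕ
deg w = sum (map degL w)

-- Elements of H^1: finite formal Q-linear combinations of words.
Poly : Set
Poly = List (ℚ × Word)

_≟w_ : (u v : Word) → Relation.Nullary.Dec (u ≡ v)
_≟w_ = ≡-dec ℕ._≟_

coeff : Poly → Word → ℚ
coeff [] u = 0ℚ
coeff ((c , w) ∷ p) u with w ≟w u
... | yes _ = c Q.+ coeff p u
... | no _ = coeff p u

_≈_ : Poly → Poly → Set
p ≈ q = ∀ u → coeff p u ≡ coeff q u

scale : ℚ → Poly → Poly
scale a p = map (λ { (c , w) → (a Q.* c , w) }) p

_⊕_ : Poly → Poly → Poly
p ⊕ q = p ++ q

_⊖_ : Poly → Poly → Poly
p ⊖ q = p ++ scale (Q.- 1ℚ) q

L : Letter → Poly → Poly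
L a p = map (λ { (c , w) → (c , a ∷ w) }) p

-- harmonic product of words:
-- 1 * w = w * 1 = w,
-- z_k u * z_l v = z_k (u * z_l v) + z_l (z_k u * v) + z_{k+l} (u * v)
-- (with the encoding, z_{a+1}, z_{b+1} give z_{a+b+2}, i.e. letter a+b+1)
mutual
  _⋆_ : Word → Word → Poly
  [] ⋆ v = (1ℚ , v) ∷ []
  (a ∷ u) ⋆ v = ⋆aux a u v

  ⋆aux : Letter → Word → Word → Poly
  ⋆aux a u [] = (1ℚ , a ∷ u) ∷ []
  ⋆aux a u (b ∷ v) =
    L a (u ⋆ (b ∷ v)) ⊕ (L b (⋆aux a u v) ⊕ L (suc (a ℕ.+ b)) (u ⋆ v))

_*H_ : Poly → Poly → Poly
p *H q = concatMap (λ { (c , u) → concatMap (λ { (d , v) → scale (c Q.* d) (u ⋆ v) }) q }) p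

H : Word → Poly → Poly
H w v = ((1ℚ , w) ∷ []) *H v

-- A formal element of W': a finite list of triples (c , k , w) standing for
-- the Q-linear combination Σ c · L_{z_k} H_w  (k ≥ 1, w a word of H^1).
FormalW' : Set
FormalW' = List (ℚ × ℕ × Word)

evalW' : FormalW' → Poly → Poly
evalW' F v = concatMap (λ { (c , k , w) → scale c (L (z k) (H w v)) }) F

-- λ : W' → W,  λ(L_{z_k} H_w) = H_{z_k w}, extended linearly
-- (well defined since the L_{z_k} H_w are linearly independent)
evalλ : FormalW' → Poly → Poly
evalλ F v = concatMap (λ { (c , k , w) → scale c (H (z k ∷ w) v) }) F

InW' : ℕ → FormalW' → Set
InW' n F = All (λ { (c , k , w) → (1 ≤ k) × (k ≤ n) × (deg w ℕ.+ k ≡ n) }) F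

-- Read as an identity of operators, the defining recursion of the harmonic product is
--   H_{z_k w} L_{z_l} = L_{z_k} H_w L_{z_l} + L_{z_l} H_{z_k w} + L_{z_{k+l}} H_w :
-- both sides are additive, and on a single word v it is the definition of z_k w * z_l v.
-- Hence (λ - 1)(L_{z_k} H_w) L_{z_l} = L_{z_l} H_{z_k w} + L_{z_{k+l}} H_w, and both
-- operators on the right are generators of W'_{k+l}.
module Submission where

open import Defs
open import Data.Nat as ℕ using (ℕ; suc; _≤_; _+_; s≤s; z≤n)
import Data.Nat.Properties as ℕP
open import Data.Rational as Q using (1ℚ; 0ℚ)
import Data.Rational.Properties as QP
open import Data.Rational.Solver using (module +-*-Solver)
open import Data.List using (List; []; _∷_; _++_; concatMap)
open import Data.List.Properties
  using (map-++; concatMap-++; ++-identityʳ; ++-assoc; ∷-injectiveˡ; ∷-injectiveʳ)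
open import Data.List.Relation.Unary.All using ([]; _∷_)
open import Data.Product using (Σ; _×_; _,_)
open import Data.Empty using (⊥-elim)
open import Function using (_∘_)
open import Relation.Binary.Bundles using (Setoid)
import Relation.Binary.Reasoning.Setoid as SetoidReasoning
open import Relation.Binary.PropositionalEquality
  using (_≡_; _≢_; refl; sym; trans; cong; cong₂; module ≡-Reasoning)
open import Relation.Nullary using (Dec; yes; no)
import Algebra.Properties.Group as GroupProperties
import Algebra.Properties.Ring as RingProperties

open +-*-Solver

≈-setoid : Setoid _ _
≈-setoid = record
  { Carrier       = Poly
  ; _≈_           = _≈_
  ; isEquivalence = record
    { refl  = λ _ → refl
    ; sym   = λ p≈q u → sym (p≈q u)
    ; trans = λ p≈q q≈r u → trans (p≈q u) (q≈r u)
    }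
  }

open Setoid ≈-setoid using () renaming (reflexive to ≡⇒≈)
module ≈-Reasoning = SetoidReasoning ≈-setoid

coeff-⊕ : ∀ p q u → coeff (p ⊕ q) u ≡ coeff p u Q.+ coeff q u
coeff-⊕ [] q u = sym (QP.+-identityˡ _)
coeff-⊕ ((c , w) ∷ p) q u with w ≟w u
... | yes _ = trans (cong (c Q.+_) (coeff-⊕ p q u)) (sym (QP.+-assoc c _ _))
... | no _  = coeff-⊕ p q u

coeff-scale : ∀ a p u → coeff (scale a p) u ≡ a Q.* coeff p u
coeff-scale a [] u = sym (QP.*-zeroʳ a)
coeff-scale a ((c , w) ∷ p) u with w ≟w u
... | yes _ = trans (cong (a Q.* c Q.+_) (coeff-scale a p u)) (sym (QP.*-distribˡ-+ a c _))
... | no _  = coeff-scale a p u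

coeff-⊖ : ∀ p q u → coeff (p ⊖ q) u ≡ coeff p u Q.- coeff q u
coeff-⊖ p q u = trans (coeff-⊕ p _ u) (cong (coeff p u Q.+_)
  (trans (coeff-scale (Q.- 1ℚ) q u) (RingProperties.-1*x≈-x QP.+-*-ring (coeff q u))))

coeff-head-≡ : ∀ c u p → coeff ((c , u) ∷ p) u ≡ c Q.+ coeff p u
coeff-head-≡ c u p with u ≟w u
... | yes _  = refl
... | no u≢u = ⊥-elim (u≢u refl)

coeff-head-≢ : ∀ c w u p → w ≢ u → coeff ((c , w) ∷ p) u ≡ coeff p u
coeff-head-≢ c w u p w≢u with w ≟w u
... | yes w≡u = ⊥-elim (w≢u w≡u)
... | no _    = refl

coeff-L-∷ : ∀ a p u → coeff (L a p) (a ∷ u) ≡ coeff p u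
coeff-L-∷ a [] u = refl
coeff-L-∷ a ((c , w) ∷ p) u = by-cases (w ≟w u)
  where
  by-cases : Dec (w ≡ u) → coeff (L a ((c , w) ∷ p)) (a ∷ u) ≡ coeff ((c , w) ∷ p) u
  by-cases (yes refl) = trans (coeff-head-≡ c (a ∷ w) (L a p))
    (trans (cong (c Q.+_) (coeff-L-∷ a p u)) (sym (coeff-head-≡ c w p)))
  by-cases (no w≢u) =
    trans (coeff-head-≢ c (a ∷ w) (a ∷ u) (L a p) (λ a∷w≡a∷u → w≢u (∷-injectiveʳ a∷w≡a∷u)))
    (trans (coeff-L-∷ a p u) (sym (coeff-head-≢ c w u p w≢u)))

coeff-L-other : ∀ a p u → (∀ v → u ≢ a ∷ v) → coeff (L a p) u ≡ 0ℚ
coeff-L-other a [] u u≢a∷ = refl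
coeff-L-other a ((c , w) ∷ p) u u≢a∷ =
  trans (coeff-head-≢ c (a ∷ w) u (L a p) (λ a∷w≡u → u≢a∷ w (sym a∷w≡u)))
    (coeff-L-other a p u u≢a∷)

L-cong : ∀ a p q → p ≈ q → L a p ≈ L a q
L-cong a p q p≈q [] =
  trans (coeff-L-other a p [] λ _ ()) (sym (coeff-L-other a q [] λ _ ()))
L-cong a p q p≈q (b ∷ u) with ℕ._≟_ a b
... | yes refl = trans (coeff-L-∷ a p u) (trans (p≈q u) (sym (coeff-L-∷ a q u)))
... | no a≢b   =
  trans (coeff-L-other a p (b ∷ u) b∷u≢a∷) (sym (coeff-L-other a q (b ∷ u) b∷u≢a∷))
  where b∷u≢a∷ : ∀ v → b ∷ u ≢ a ∷ v
        b∷u≢a∷ v eq = a≢b (sym (∷-injectiveˡ eq))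

-- _≈_ unfolds to pointwise equality of coefficients, from which Agda cannot recover
-- the polynomials being compared, so they are supplied by hand wherever ≈ is composed.
⊕-cong : ∀ {p p′ q q′} → p ≈ p′ → q ≈ q′ → (p ⊕ q) ≈ (p′ ⊕ q′)
⊕-cong {p} {p′} {q} {q′} p≈p′ q≈q′ u = begin
  coeff (p ⊕ q) u            ≡⟨ coeff-⊕ p q u ⟩
  coeff p u Q.+ coeff q u    ≡⟨ cong₂ Q._+_ (p≈p′ u) (q≈q′ u) ⟩
  coeff p′ u Q.+ coeff q′ u  ≡⟨ coeff-⊕ p′ q′ u ⟨
  coeff (p′ ⊕ q′) u          ∎
  where open ≡-Reasoning

⊖-congˡ : ∀ p p′ q → p ≈ p′ → (p ⊖ q) ≈ (p′ ⊖ q)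
⊖-congˡ p p′ q p≈p′ = ⊕-cong {p} {p′} {scale (Q.- 1ℚ) q} p≈p′ λ _ → refl

scale-cong : ∀ c p q → p ≈ q → scale c p ≈ scale c q
scale-cong c p q p≈q u =
  trans (coeff-scale c p u) (trans (cong (c Q.*_) (p≈q u)) (sym (coeff-scale c q u)))

scale-⊕ : ∀ c p q → scale c (p ⊕ q) ≡ (scale c p ⊕ scale c q)
scale-⊕ c = map-++ _

L-⊕ : ∀ a p q → L a (p ⊕ q) ≡ (L a p ⊕ L a q)
L-⊕ a = map-++ _

L-scale : ∀ a c p → L a (scale c p) ≡ scale c (L a p)
L-scale a c [] = refl
L-scale a c ((d , w) ∷ p) = cong ((c Q.* d , a ∷ w) ∷_) (L-scale a c p)

scale-⊖ : ∀ c p q → scale c (p ⊖ q) ≈ (scale c p ⊖ scale c q)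
scale-⊖ c p q u
  rewrite coeff-scale c (p ⊖ q) u | coeff-⊖ p q u
        | coeff-⊖ (scale c p) (scale c q) u | coeff-scale c p u | coeff-scale c q u
  = solve 3 (λ c x y → c :* (x :- y) := c :* x :- c :* y) refl c (coeff p u) (coeff q u)

⊕-interchange : ∀ p q r s → ((p ⊕ q) ⊕ (r ⊕ s)) ≈ ((p ⊕ r) ⊕ (q ⊕ s))
⊕-interchange p q r s u
  rewrite coeff-⊕ (p ⊕ q) (r ⊕ s) u | coeff-⊕ p q u | coeff-⊕ r s u
        | coeff-⊕ (p ⊕ r) (q ⊕ s) u | coeff-⊕ p r u | coeff-⊕ q s u
  = solve 4 (λ p q r s → (p :+ q) :+ (r :+ s) := (p :+ r) :+ (q :+ s)) refl
      (coeff p u) (coeff q u) (coeff r u) (coeff s u)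

⊖-interchange : ∀ p q r s → ((p ⊕ q) ⊖ (r ⊕ s)) ≈ ((p ⊖ r) ⊕ (q ⊖ s))
⊖-interchange p q r s u
  rewrite coeff-⊖ (p ⊕ q) (r ⊕ s) u | coeff-⊕ p q u | coeff-⊕ r s u
        | coeff-⊕ (p ⊖ r) (q ⊖ s) u | coeff-⊖ p r u | coeff-⊖ q s u
  = solve 4 (λ p q r s → (p :+ q) :- (r :+ s) := (p :- r) :+ (q :- s)) refl
      (coeff p u) (coeff q u) (coeff r u) (coeff s u)

⊕-⊖-cancelˡ : ∀ p q → ((p ⊕ q) ⊖ p) ≈ q
⊕-⊖-cancelˡ p q u rewrite coeff-⊖ (p ⊕ q) p u | coeff-⊕ p q u
  = solve 2 (λ p q → (p :+ q) :- p := q) refl (coeff p u) (coeff q u)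

Additive : (Poly → Poly) → Set
Additive F = ∀ p q → F (p ⊕ q) ≈ (F p ⊕ F q)

additive-[] : ∀ F → Additive F → F [] ≈ []
additive-[] F F-additive u =
  identityʳ-unique (coeff (F []) u) _
    (sym (trans (F-additive [] [] u) (coeff-⊕ (F []) (F []) u)))
  where open GroupProperties QP.+-0-group using (identityʳ-unique)

additive-ext : ∀ F G → Additive F → Additive G →
  (∀ t → F (t ∷ []) ≈ G (t ∷ [])) → ∀ p → F p ≈ G p
additive-ext F G F-additive G-additive agree [] = begin
  F []  ≈⟨ additive-[] F F-additive ⟩
  []    ≈⟨ additive-[] G G-additive ⟨
  G []  ∎
  where open ≈-Reasoning
additive-ext F G F-additive G-additive agree (t ∷ p) = begin
  F (t ∷ p)         ≈⟨ F-additive (t ∷ []) p ⟩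
  F (t ∷ []) ⊕ F p  ≈⟨ ⊕-cong {F (t ∷ [])} {G (t ∷ [])} {F p} {G p}
                         (agree t) (additive-ext F G F-additive G-additive agree p) ⟩
  G (t ∷ []) ⊕ G p  ≈⟨ G-additive (t ∷ []) p ⟨
  G (t ∷ p)         ∎
  where open ≈-Reasoning

H-⊕ : ∀ s p q → H s (p ⊕ q) ≡ (H s p ⊕ H s q)
H-⊕ s p q = concatMap-++-[] _ p q
  where
  concatMap-++-[] : ∀ {A B : Set} (f : A → List B) xs ys →
    concatMap f (xs ++ ys) ++ [] ≡ (concatMap f xs ++ []) ++ (concatMap f ys ++ [])
  concatMap-++-[] f xs ys = trans (++-identityʳ _) (trans (concatMap-++ f xs ys)
    (sym (cong₂ _++_ (++-identityʳ (concatMap f xs)) (++-identityʳ (concatMap f ys)))))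

H-additive : ∀ s → Additive (H s)
H-additive s p q = ≡⇒≈ (H-⊕ s p q)

H-monomial : ∀ s d v → H s ((d , v) ∷ []) ≡ scale d (s ⋆ v)
H-monomial s d v = trans (++-identityʳ _) (trans (++-identityʳ _)
  (cong (λ e → scale e (s ⋆ v)) (QP.*-identityˡ d)))

L∘-additive : ∀ a F → Additive F → Additive (L a ∘ F)
L∘-additive a F F-additive p q = begin
  L a (F (p ⊕ q))      ≈⟨ L-cong a (F (p ⊕ q)) (F p ⊕ F q) (F-additive p q) ⟩
  L a (F p ⊕ F q)      ≡⟨ L-⊕ a (F p) (F q) ⟩
  L a (F p) ⊕ L a (F q) ∎
  where open ≈-Reasoning

∘L-additive : ∀ a F → Additive F → Additive (F ∘ L a)
∘L-additive a F F-additive p q = begin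
  F (L a (p ⊕ q))       ≡⟨ cong F (L-⊕ a p q) ⟩
  F (L a p ⊕ L a q)     ≈⟨ F-additive (L a p) (L a q) ⟩
  F (L a p) ⊕ F (L a q) ∎
  where open ≈-Reasoning

⊕-additive : ∀ F G → Additive F → Additive G → Additive (λ p → F p ⊕ G p)
⊕-additive F G F-additive G-additive p q = begin
  F (p ⊕ q) ⊕ G (p ⊕ q)
    ≈⟨ ⊕-cong {F (p ⊕ q)} {F p ⊕ F q} {G (p ⊕ q)} {G p ⊕ G q}
         (F-additive p q) (G-additive p q) ⟩
  (F p ⊕ F q) ⊕ (G p ⊕ G q)
    ≈⟨ ⊕-interchange (F p) (F q) (G p) (G q) ⟩
  (F p ⊕ G p) ⊕ (F q ⊕ G q)
    ∎
  where open ≈-Reasoning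

H-∷-L : ∀ a b w v →
  H (a ∷ w) (L b v) ≈ (L a (H w (L b v)) ⊕ (L b (H (a ∷ w) v) ⊕ L (suc (a + b)) (H w v)))
H-∷-L a b w = additive-ext (H (a ∷ w) ∘ L b) (λ v → L a (H w (L b v)) ⊕ rest v)
  (∘L-additive b (H (a ∷ w)) (H-additive (a ∷ w)))
  (⊕-additive (L a ∘ H w ∘ L b) rest
    (L∘-additive a (H w ∘ L b) (∘L-additive b (H w) (H-additive w)))
    (⊕-additive (L b ∘ H (a ∷ w)) (L c ∘ H w)
      (L∘-additive b (H (a ∷ w)) (H-additive (a ∷ w)))
      (L∘-additive c (H w) (H-additive w))))
  (λ { (d , v) → ≡⇒≈ (on-monomial d v) })
  where
  c = suc (a + b)
  rest : Poly → Poly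
  rest v = L b (H (a ∷ w) v) ⊕ L c (H w v)
  on-monomial : ∀ d v →
    H (a ∷ w) ((d , b ∷ v) ∷ []) ≡ (L a (H w ((d , b ∷ v) ∷ [])) ⊕ rest ((d , v) ∷ []))
  on-monomial d v = begin
    H (a ∷ w) ((d , b ∷ v) ∷ [])
      ≡⟨ H-monomial (a ∷ w) d (b ∷ v) ⟩
    scale d (L a X ⊕ (L b Y ⊕ L c Z))
      ≡⟨ trans (scale-⊕ d (L a X) _) (cong (scale d (L a X) ⊕_) (scale-⊕ d (L b Y) (L c Z))) ⟩
    (scale d (L a X) ⊕ (scale d (L b Y) ⊕ scale d (L c Z)))
      ≡⟨ sym (cong₂ _⊕_ (L-scale a d X) (cong₂ _⊕_ (L-scale b d Y) (L-scale c d Z))) ⟩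
    (L a (scale d X) ⊕ (L b (scale d Y) ⊕ L c (scale d Z)))
      ≡⟨ sym (cong₂ _⊕_ (cong (L a) (H-monomial w d (b ∷ v)))
               (cong₂ _⊕_ (cong (L b) (H-monomial (a ∷ w) d v))
                          (cong (L c) (H-monomial w d v)))) ⟩
    (L a (H w ((d , b ∷ v) ∷ [])) ⊕ rest ((d , v) ∷ []))
      ∎
    where
    open ≡-Reasoning
    X = w ⋆ (b ∷ v)
    Y = (a ∷ w) ⋆ v
    Z = w ⋆ v

λ-minus-id-generator : ∀ a b w v →
  (H (a ∷ w) (L b v) ⊖ L a (H w (L b v))) ≈ (L b (H (a ∷ w) v) ⊕ L (suc (a + b)) (H w v))
λ-minus-id-generator a b w v = begin
  H (a ∷ w) (L b v) ⊖ A  ≈⟨ ⊖-congˡ (H (a ∷ w) (L b v)) (A ⊕ B) A (H-∷-L a b w v) ⟩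
  (A ⊕ B) ⊖ A            ≈⟨ ⊕-⊖-cancelˡ A B ⟩
  B                      ∎
  where
  open ≈-Reasoning
  A = L a (H w (L b v))
  B = L b (H (a ∷ w) v) ⊕ L (suc (a + b)) (H w v)

λ-minus-id-L : ℕ → FormalW' → FormalW'
λ-minus-id-L l [] = []
λ-minus-id-L l ((c , k , w) ∷ X) = (c , l , z k ∷ w) ∷ (c , k + l , w) ∷ λ-minus-id-L l X

λ-minus-id-L-∈W' : ∀ k l → 1 ≤ l → ∀ X → InW' k X → InW' (k + l) (λ-minus-id-L l X)
λ-minus-id-L-∈W' k l 1≤l [] [] = []
λ-minus-id-L-∈W' k l 1≤l ((c , suc i , w) ∷ X) ((_ , 1+i≤k , deg-w+1+i≡k) ∷ X∈W'k) =
  (1≤l , ℕP.m≤n+m l k , cong (_+ l) (trans (ℕP.+-comm (suc i) (deg w)) deg-w+1+i≡k))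
  ∷ (s≤s z≤n , ℕP.+-monoˡ-≤ l 1+i≤k ,
     trans (sym (ℕP.+-assoc (deg w) (suc i) l)) (cong (_+ l) deg-w+1+i≡k))
  ∷ λ-minus-id-L-∈W' k l 1≤l X X∈W'k

λ-minus-id-L-correct : ∀ n j X → InW' n X → ∀ v →
  (evalλ X (L j v) ⊖ evalW' X (L j v)) ≈ evalW' (λ-minus-id-L (suc j) X) v
λ-minus-id-L-correct n j [] [] v u = refl
λ-minus-id-L-correct n j ((c , suc i , w) ∷ X) (_ ∷ X∈W'n) v = begin
  (scale c A ⊕ evalλ X p) ⊖ (scale c B ⊕ evalW' X p)
    ≈⟨ ⊖-interchange (scale c A) (evalλ X p) (scale c B) (evalW' X p) ⟩
  (scale c A ⊖ scale c B) ⊕ (evalλ X p ⊖ evalW' X p)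
    ≈⟨ ⊕-cong {scale c A ⊖ scale c B} {scale c A′ ⊕ scale c B′} {evalλ X p ⊖ evalW' X p} {R}
         generator-step (λ-minus-id-L-correct n j X X∈W'n v) ⟩
  (scale c A′ ⊕ scale c B′) ⊕ R
    ≡⟨ ++-assoc (scale c A′) (scale c B′) R ⟩
  scale c A′ ⊕ (scale c B′ ⊕ R)
    ≡⟨ cong (λ m → scale c A′ ⊕ (scale c (L m (H w v)) ⊕ R)) (ℕP.+-suc i j) ⟨
  evalW' (λ-minus-id-L (suc j) ((c , suc i , w) ∷ X)) v
    ∎
  where
  open ≈-Reasoning
  p  = L j v
  A  = H (i ∷ w) p
  B  = L i (H w p)
  A′ = L j (H (i ∷ w) v)
  B′ = L (suc (i + j)) (H w v)
  R  = evalW' (λ-minus-id-L (suc j) X) v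
  generator-step : (scale c A ⊖ scale c B) ≈ (scale c A′ ⊕ scale c B′)
  generator-step = begin
    scale c A ⊖ scale c B    ≈⟨ scale-⊖ c A B ⟨
    scale c (A ⊖ B)          ≈⟨ scale-cong c (A ⊖ B) (A′ ⊕ B′) (λ-minus-id-generator i j w v) ⟩
    scale c (A′ ⊕ B′)        ≡⟨ scale-⊕ c A′ B′ ⟩
    scale c A′ ⊕ scale c B′  ∎

lemma4p12 : (k l : ℕ) → 1 ≤ k → 1 ≤ l → (X : FormalW') → InW' k X →
    Σ FormalW' (λ Y → InW' (k + l) Y ×
      ((v : Poly) → (evalλ X (L (z l) v) ⊖ evalW' X (L (z l) v)) ≈ evalW' Y v))
lemma4p12 k (suc j) _ 1≤l X X∈W'k =
  λ-minus-id-L (suc j) X ,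
  λ-minus-id-L-∈W' k (suc j) 1≤l X X∈W'k ,
  λ-minus-id-L-correct k j X X∈W'k
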